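{- Let $G=(V,E,w)$ be a weighted graph, let $D$ be a dendrogram of $G$, and let $m_1,\ldots,m_r$ be a greedy merge sequence of $D$. Let $1+\epsilon$ be the maximum error of a merge in this sequence. Then $D$ is $(1+\epsilon)$-approximate, and $D$ is not $(1+\epsilon')$-approximate for any $\epsilon'<\epsilon$.
   Context: $G=(V,E,w)$ is a finite undirected graph with positive edge weights. For disjoint nonempty $X,Y\subseteq V$, $w(X,Y)=\frac{1}{|X||Y|}\sum_{xy\in E,x\in X,y\in Y}w(xy)$. Given a partition of $V$ into clusters, the contracted graph has the clusters as vertices and an edge of weight $w(X,Y)$ between $X,Y$ iff $w(X,Y)>0$. A run of HAC starts from all-singleton clusters and repeatedly merges two clusters $X,Y$ with $w(X,Y)>0$ into $X\cup Y$, until no two clusters have positive similarity. The dendrogram of such a run is the rooted binary forest whose leaves are the singletons and which has, for each merge of $X$ and $Y$, a node $X\cup Y$ with children $X$ and $Y$; a dendrogram of $G$ is the dendrogram of some such run. Its merge tree is obtained by deleting the leaves; each node is a merge, whose (linkage) similarity is $w(X,Y)$ for the two merged clusters $X,Y$. A sequence of merges of the merge tree is consistent with it if every merge appears after the merges that are its children in the merge tree. For a consistent sequence $m_1,\ldots,m_r$ of all merges, the error of $m_j$ is the maximum edge weight in the contracted graph obtained by applying $m_1,\ldots,m_{j-1}$, divided by the similarity of $m_j$. A greedy merge sequence of $D$ is built starting from the empty sequence by repeatedly appending a merge of maximum similarity among the not-yet-appended merges whose appending keeps the sequence consistent with the merge tree, until all merges are appended. A merge of $X,Y$ in a contracted graph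 $H$ is $(1+\epsilon)$-approximate if $(1+\epsilon)w(X,Y)\ge$ the maximum edge weight of $H$. $D$ is $(1+\epsilon)$-approximate if there is a sequence of merges, consistent with the merge tree of $D$ and containing all its merges, in which every merge is $(1+\epsilon)$-approximate with respect to the graph obtained by applying the preceding merges, and after which no pair of clusters has nonzero similarity.
   Formalization: The edge weights of G, and the parameters ε and ε′, are rational. -}

module Defs where

open import Data.Nat as ℕ using (ℕ; zero; suc)
open import Data.Integer using (+_)
open import Data.Rational as ℚ using (ℚ; 0ℚ; 1ℚ; _+_; _*_; _≤_; _<_; _÷_; _⊔_; ≢-nonZero)
open import Data.Bool using (Bool; true; false; _∧_; if_then_else_; not)
open import Data.Fin using (Fin; toℕ)
open import Data.Fin.Subset using (Subset; ⁅_⁆; _∪_; ∣_∣)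
open import Data.Vec using (lookup)
import Data.Vec.Properties as VecP
import Data.Bool.Properties as BoolP
open import Data.List as List using (List; []; _∷_; map; foldr; filter; allFin; take; length; concatMap)
open import Data.List.Membership.Propositional using (_∈_; _∉_)
open import Data.List.Relation.Unary.All using (All)
open import Data.List.Relation.Binary.Permutation.Propositional using (_↭_)
open import Data.Product using (Σ; _×_; _,_; ∃; proj₁; proj₂)
open import Data.Sum using (_⊎_)
open import Relation.Binary.PropositionalEquality using (_≡_; _≢_)
open import Relation.Nullary using (Dec; yes; no; ¬_)
open import Relation.Nullary.Decidable using (⌊_⌋)

-- Weighted graphs on the vertex set Fin n.
-- w x y > 0 iff xy is an edge (of weight w x y); w x y ≡ 0 otherwise.

record WGraph (n : ℕ) : Set where
  field
    w        : Fin n → Fin n → ℚ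
    w-sym    : ∀ x y → w x y ≡ w y x
    w-nonneg : ∀ x y → 0ℚ ≤ w x y
    w-noloop : ∀ x → w x x ≡ 0ℚ
open WGraph public

Cluster : ℕ → Set
Cluster n = Subset n

_≟C_ : ∀ {n} (X Y : Cluster n) → Dec (X ≡ Y)
_≟C_ = VecP.≡-dec BoolP._≟_

-- rational division, returning 0 when dividing by 0 (never used with 0
-- in the statement: merge similarities in a HAC run are positive)
divQ : ℚ → ℚ → ℚ
divQ p q with q ℚ.≟ 0ℚ
... | yes _ = 0ℚ
... | no q≢0 = _÷_ p q {{≢-nonZero q≢0}}

sumQ : List ℚ → ℚ
sumQ = foldr _+_ 0ℚ

maxQ : List ℚ → ℚ
maxQ = foldr _⊔_ 0ℚ

-- total weight of edges between X and Y (X, Y disjoint, so summing over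
-- ordered pairs (x , y) with x ∈ X, y ∈ Y counts each edge once)
crossWeight : ∀ {n} → WGraph n → Cluster n → Cluster n → ℚ
crossWeight {n} G X Y =
  sumQ (concatMap (λ x → map (λ y → if lookup X x ∧ lookup Y y then w G x y else 0ℚ)
                             (allFin n))
                  (allFin n))

sim : ∀ {n} → WGraph n → Cluster n → Cluster n → ℚ
sim G X Y = divQ (crossWeight G X Y) ((+ (∣ X ∣ ℕ.* ∣ Y ∣)) ℚ./ 1)

Partition : ℕ → Set
Partition n = List (Cluster n)

Merge : ℕ → Set
Merge n = Cluster n × Cluster n

singletons : ∀ n → Partition n
singletons n = map ⁅_⁆ (allFin n)

result : ∀ {n} → Merge n → Cluster n
result (X , Y) = X ∪ Y

applyMerge : ∀ {n} → Partition n → Merge n → Partition n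
applyMerge P (X , Y) =
  (X ∪ Y) ∷ filter (λ Z → (not ⌊ Z ≟C X ⌋ ∧ not ⌊ Z ≟C Y ⌋) ≟b true) P
  where
    _≟b_ : (a b : Bool) → Dec (a ≡ b)
    _≟b_ = BoolP._≟_

applyMerges : ∀ {n} → Partition n → List (Merge n) → Partition n
applyMerges = List.foldl applyMerge

-- weights w(A,B) of all pairs of distinct clusters of a partition
-- (pairs taken by position; the clusters of a partition are distinct)
pairSims : ∀ {n} → WGraph n → Partition n → List ℚ
pairSims G []      = []
pairSims G (A ∷ P) = map (sim G A) P List.++ pairSims G P

-- maximum edge weight of the contracted graph (0 if it has no edges;
-- non-edges have weight 0 and all weights are ≥ 0)
maxEdge : ∀ {n} → WGraph n → Partition n → ℚ
maxEdge G P = maxQ (pairSims G P)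

Terminal : ∀ {n} → WGraph n → Partition n → Set
Terminal G P = All (_≡ 0ℚ) (pairSims G P)

RunFrom : ∀ {n} → WGraph n → Partition n → List (Merge n) → Set
RunFrom G P []             = Terminal G P
RunFrom G P ((X , Y) ∷ ms) =
  X ∈ P × Y ∈ P × X ≢ Y × 0ℚ < sim G X Y × RunFrom G (applyMerge P (X , Y)) ms

-- D (a list of merges, i.e. the nodes X ∪ Y of the merge tree with
-- children X and Y) is a dendrogram of G: it comes from a HAC run.
IsDendrogram : ∀ {n} → WGraph n → List (Merge n) → Set
IsDendrogram {n} G D = RunFrom G (singletons n) D

IsChild : ∀ {n} → Merge n → Merge n → Set
IsChild c (X , Y) = (result c ≡ X) ⊎ (result c ≡ Y)

Consistent : ∀ {n} → List (Merge n) → List (Merge n) → Set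
Consistent D s =
  (s ↭ D) ×
  (∀ (i j : Fin (length s)) → IsChild (List.lookup s i) (List.lookup s j) →
     toℕ i ℕ.< toℕ j)

before : ∀ {n} → List (Merge n) → ℕ → Partition n
before {n} s j = applyMerges (singletons n) (take j s)

simM : ∀ {n} → WGraph n → Merge n → ℚ
simM G (X , Y) = sim G X Y

errorAt : ∀ {n} → WGraph n → (s : List (Merge n)) → Fin (length s) → ℚ
errorAt G s j = divQ (maxEdge G (before s (toℕ j))) (simM G (List.lookup s j))

IsMaxError : ∀ {n} → WGraph n → List (Merge n) → ℚ → Set
IsMaxError G s α =
  (∃ λ j → errorAt G s j ≡ α) × (∀ j → errorAt G s j ≤ α)

-- m (a merge of D) may be appended to the prefix p keeping consistency:
-- all of its children in the merge tree are already in p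
Available : ∀ {n} → List (Merge n) → List (Merge n) → Merge n → Set
Available D p m = ∀ c → c ∈ D → IsChild c m → c ∈ p

IsGreedy : ∀ {n} → WGraph n → List (Merge n) → List (Merge n) → Set
IsGreedy G D s =
  (s ↭ D) ×
  (∀ (j : Fin (length s)) →
     let p = take (toℕ j) s ; mj = List.lookup s j in
     mj ∉ p × Available D p mj ×
     (∀ m → m ∈ D → m ∉ p → Available D p m → simM G m ≤ simM G mj))

Approximate : ∀ {n} → WGraph n → List (Merge n) → ℚ → Set
Approximate G D α =
  Σ (List _) λ s → Consistent D s ×
    (∀ (j : Fin (length s)) →
       maxEdge G (before s (toℕ j)) ≤ α * simM G (List.lookup s j)) ×
    Terminal G (applyMerges (singletons _) s)

-- The greedy sequence s itself witnesses (1+ε)-approximation: it lists every merge of D after its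
-- children, each of its errors is at most 1+ε, and since the clusters present after a set of merges
-- do not depend on the order in which they are performed, s ends in the same terminal partition as D.
--
-- Conversely, let s′ witness (1+ε′)-approximation and let m_j be a merge of s with error 1+ε. Let m
-- be the first merge of s′ that is not among the first j merges of s. Its children precede it in s′,
-- so m was available to the greedy algorithm at step j, whence w(m) ≤ w(m_j). Average linkage is
-- reducible, w(X ∪ Y, C) ≤ max (w(X, C), w(Y, C)), so performing the remaining first j greedy merges
-- after the merges that precede m in s′ cannot raise the maximum edge weight. Therefore
--   (1+ε) w(m_j) = (max edge before m_j in s) ≤ (max edge before m in s′) ≤ (1+ε′) w(m) ≤ (1+ε′) w(m_j),
-- and ε ≤ ε′.

module Submission where

open import Defs
open import Data.Nat using (ℕ)
open import Data.Rational using (ℚ; 1ℚ; _+_; _<_)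
open import Data.List using (List)
open import Data.Product using (_×_)
open import Relation.Nullary using (¬_)

open import Data.Bool using (true; false; not; _∧_; _∨_; if_then_else_)
open import Data.Empty using (⊥; ⊥-elim)
open import Data.Fin using (Fin; zero; suc; toℕ)
open import Data.Fin.Subset using (⁅_⁆; _∪_; ∣_∣; Nonempty) renaming (_∈_ to _∈ₛ_; _⊆_ to _⊆ₛ_)
import Data.Fin.Subset.Properties as Subset
import Data.Integer as ℤ
import Data.Integer.Properties as ℤ
open import Data.List as List using ([]; _∷_; _++_; _∷ʳ_; map; concatMap; allFin; tabulate; take; length)
import Data.List.Properties as List
open import Data.List.Membership.Propositional using (_∈_; _∉_)
open import Data.List.Membership.Propositional.Properties
  using (∈-filter⁻; ∈-filter⁺; ∈-map⁻; ∈-map⁺; ∈-++⁻; ∈-++⁺ˡ; ∈-++⁺ʳ; ∈-lookup)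
open import Data.List.Relation.Binary.Permutation.Propositional using (_↭_; ↭-sym)
open import Data.List.Relation.Binary.Permutation.Propositional.Properties using (∈-resp-↭)
open import Data.List.Relation.Binary.Sublist.Propositional using () renaming (lookup to sublist-lookup)
open import Data.List.Relation.Binary.Sublist.Propositional.Properties using (take-⊆; take⁺)
open import Data.List.Relation.Unary.All as All using (All)
open import Data.List.Relation.Unary.AllPairs using (_∷_)
open import Data.List.Relation.Unary.Any as Any using (here; there)
import Data.List.Relation.Unary.Any.Properties as Any
open import Data.List.Relation.Unary.First as First using (First)
import Data.List.Relation.Unary.First.Properties as First
open import Data.List.Relation.Unary.Unique.Propositional using (Unique)
import Data.List.Relation.Unary.Unique.Propositional.Properties as Unique
open import Data.Nat as ℕ using (zero; suc)
import Data.Nat.Properties as ℕ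
open import Data.Nat.Coprimality as Coprime using (Coprime)
open import Data.Product using (_,_; proj₁; proj₂; ∃; ∃₂)
import Data.Product.Properties as Product
open import Data.Rational as ℚ using (0ℚ; _*_; _≤_; _⊔_; _/_; 1/_; NonZero; ≢-nonZero; positive; nonNegative)
open import Data.Rational.Properties
open import Algebra.Properties.CommutativeMonoid.Sum +-0-commutativeMonoid
  using (sum; sum-syntax; sum-cong-≗; ∑-comm; ∑-distrib-+)
open import Data.Sum using (_⊎_; inj₁; inj₂; [_,_])
open import Data.Vec using ([]; _∷_; lookup) renaming (here to hereᵥ; there to thereᵥ)
import Data.Vec.Properties as Vec
open import Function using (_∘_)
open import Relation.Binary.Definitions using (tri<; tri≈; tri>)
open import Relation.Binary.PropositionalEquality
  using (_≡_; _≢_; refl; sym; trans; cong; cong₂; subst; subst₂; module ≡-Reasoning)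
open import Relation.Nullary using (Dec; yes; no; contradiction)
open import Relation.Nullary.Decidable using (⌊_⌋)

∈-take⁻ : ∀ {A : Set} {x : A} k xs → x ∈ take k xs → x ∈ xs
∈-take⁻ k xs = sublist-lookup (take-⊆ k xs)

∈-∷ʳ⁻ : ∀ {A : Set} {x y : A} xs → x ∈ xs ∷ʳ y → x ∈ xs ⊎ x ≡ y
∈-∷ʳ⁻ xs x∈ = [ inj₁ , (λ { (here x≡y) → inj₂ x≡y ; (there ()) }) ] (∈-++⁻ xs x∈)

lookup∈take : ∀ {A : Set} (xs : List A) i {k} → toℕ i ℕ.< k → List.lookup xs i ∈ take k xs
lookup∈take (x ∷ xs) zero    {suc k} _           = here refl
lookup∈take (x ∷ xs) (suc i) {suc k} (ℕ.s<s i<k) = there (lookup∈take xs i i<k)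

First-prefix : ∀ {A : Set} {P Q : A → Set} {xs} (first : First P Q xs) →
               All P (take (toℕ (First.index first)) xs)
First-prefix First.[ _ ]        = All.[]
First-prefix (px First.∷ first) = px All.∷ First-prefix first

toℚ : ℕ → ℚ
toℚ k = ℤ.+ k / 1

toℚ-+ : ∀ a b → toℚ (a ℕ.+ b) ≡ toℚ a + toℚ b
toℚ-+ a b = begin
  toℚ (a ℕ.+ b)
    ≡⟨ cong (_/ 1) (cong₂ ℤ._+_ (ℤ.*-identityʳ (ℤ.+ a)) (ℤ.*-identityʳ (ℤ.+ b))) ⟨
  (ℤ.+ a ℤ.* ℤ.+ 1 ℤ.+ ℤ.+ b ℤ.* ℤ.+ 1) / 1
    ≡⟨⟩
  ℚ.mkℚ (ℤ.+ a) 0 (c a) + ℚ.mkℚ (ℤ.+ b) 0 (c b)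
    ≡⟨ cong₂ _+_ (normalize-coprime (c a)) (normalize-coprime (c b)) ⟨
  toℚ a + toℚ b
    ∎
  where
  open ≡-Reasoning
  c : ∀ k → Coprime k 1
  c k = Coprime.sym (Coprime.1-coprimeTo k)

toℚ-nonNeg : ∀ k → 0ℚ ≤ toℚ k
toℚ-nonNeg k = nonNegative⁻¹ (toℚ k) {{normalize-nonNeg k 1}}

toℚ-*-pos : ∀ {a b} → 0 ℕ.< a → 0 ℕ.< b → 0ℚ < toℚ (a ℕ.* b)
toℚ-*-pos {suc a} {suc b} _ _ = positive⁻¹ _ {{normalize-pos (suc a ℕ.* suc b) 1}}

divQ-*-cancel : ∀ p {q} → 0ℚ < q → divQ p q * q ≡ p
divQ-*-cancel p {q} 0<q with q ℚ.≟ 0ℚ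
... | yes q≡0 = contradiction (sym q≡0) (<⇒≢ 0<q)
... | no q≢0 = begin
  p * 1/ q * q    ≡⟨ *-assoc p (1/ q) q ⟩
  p * (1/ q * q)  ≡⟨ cong (p *_) (*-inverseˡ q) ⟩
  p * 1ℚ          ≡⟨ *-identityʳ p ⟩
  p               ∎
  where
  open ≡-Reasoning
  instance
    q-nonZero : NonZero q
    q-nonZero = ≢-nonZero q≢0

divQ-≤⇒≤-* : ∀ {p q r} → 0ℚ < q → divQ p q ≤ r → p ≤ r * q
divQ-≤⇒≤-* {p} {q} 0<q le =
  subst (_≤ _) (divQ-*-cancel p 0<q) (*-monoʳ-≤-nonNeg q {{pos⇒nonNeg q {{positive 0<q}}}} le)

≤-*⇒divQ-≤ : ∀ {p q r} → 0ℚ < q → p ≤ r * q → divQ p q ≤ r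
≤-*⇒divQ-≤ {p} {q} 0<q le =
  *-cancelʳ-≤-pos q {{positive 0<q}} (subst (_≤ _) (sym (divQ-*-cancel p 0<q)) le)

divQ-nonNeg : ∀ {p q} → 0ℚ ≤ p → 0ℚ ≤ q → 0ℚ ≤ divQ p q
divQ-nonNeg {p} {q} 0≤p 0≤q with <-cmp 0ℚ q
... | tri< 0<q _ _  = *-cancelʳ-≤-pos q {{positive 0<q}}
                        (subst₂ _≤_ (sym (*-zeroˡ q)) (sym (divQ-*-cancel p 0<q)) 0≤p)
... | tri≈ _ refl _ = ≤-refl
... | tri> _ _ q<0  = ⊥-elim (<-irrefl refl (<-≤-trans q<0 0≤q))

divQ-mediant : ∀ a b {p q} → 0ℚ < p → 0ℚ < q → divQ (a + b) (p + q) ≤ divQ a p ⊔ divQ b q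
divQ-mediant a b {p} {q} 0<p 0<q = ≤-*⇒divQ-≤ (+-mono-< 0<p 0<q) (begin
  a + b          ≤⟨ +-mono-≤ (divQ-≤⇒≤-* 0<p (p≤p⊔q _ (divQ b q)))
                             (divQ-≤⇒≤-* 0<q (p≤q⊔p (divQ a p) _)) ⟩
  M * p + M * q  ≡⟨ *-distribˡ-+ M p q ⟨
  M * (p + q)    ∎)
  where
  open ≤-Reasoning
  M = divQ a p ⊔ divQ b q

*-cancel-≤-smaller : ∀ {α β a b} → 0ℚ < b → b ≤ a → 0ℚ ≤ β * b → α * a ≤ β * b → α ≤ β
*-cancel-≤-smaller {α} {β} {a} {b} 0<b b≤a 0≤βb αa≤βb =
  *-cancelʳ-≤-pos a {{positive (<-≤-trans 0<b b≤a)}}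
    (≤-trans αa≤βb (*-monoˡ-≤-nonNeg β {{nonNegative 0≤β}} b≤a))
  where
  0≤β : 0ℚ ≤ β
  0≤β = *-cancelʳ-≤-pos b {{positive 0<b}} (subst (_≤ β * b) (sym (*-zeroˡ b)) 0≤βb)

sumQ-++ : ∀ xs ys → sumQ (xs ++ ys) ≡ sumQ xs + sumQ ys
sumQ-++ []       ys = sym (+-identityˡ _)
sumQ-++ (x ∷ xs) ys = trans (cong (x +_) (sumQ-++ xs ys)) (sym (+-assoc x _ _))

sumQ-concatMap : ∀ {A : Set} (f : A → List ℚ) xs → sumQ (concatMap f xs) ≡ sumQ (map (sumQ ∘ f) xs)
sumQ-concatMap f []       = refl
sumQ-concatMap f (x ∷ xs) = trans (sumQ-++ (f x) _) (cong (sumQ (f x) +_) (sumQ-concatMap f xs))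

sumQ-tabulate : ∀ {n} (f : Fin n → ℚ) → sumQ (tabulate f) ≡ sum f
sumQ-tabulate {zero}  f = refl
sumQ-tabulate {suc n} f = cong (f zero +_) (sumQ-tabulate (f ∘ suc))

sumQ-allFin : ∀ {n} (f : Fin n → ℚ) → sumQ (map f (allFin n)) ≡ sum f
sumQ-allFin f = trans (cong sumQ (List.map-tabulate (λ i → i) f)) (sumQ-tabulate f)

sum-nonNeg : ∀ {n} (f : Fin n → ℚ) → (∀ i → 0ℚ ≤ f i) → 0ℚ ≤ sum f
sum-nonNeg {zero}  f 0≤f = ≤-refl
sum-nonNeg {suc n} f 0≤f = +-mono-≤ (0≤f zero) (sum-nonNeg (f ∘ suc) (0≤f ∘ suc))

maxQ-≥ : ∀ {x} l → x ∈ l → x ≤ maxQ l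
maxQ-≥ (y ∷ l) (here refl) = p≤p⊔q y (maxQ l)
maxQ-≥ (y ∷ l) (there x∈l) = ≤-trans (maxQ-≥ l x∈l) (p≤q⊔p y (maxQ l))

maxQ-nonNeg : ∀ l → 0ℚ ≤ maxQ l
maxQ-nonNeg []      = ≤-refl
maxQ-nonNeg (y ∷ l) = ≤-trans (maxQ-nonNeg l) (p≤q⊔p y (maxQ l))

maxQ-≤ : ∀ {e} l → 0ℚ ≤ e → All (_≤ e) l → maxQ l ≤ e
maxQ-≤ []      0≤e All.[]            = 0≤e
maxQ-≤ (y ∷ l) 0≤e (y≤e All.∷ l≤e) = ⊔-lub y≤e (maxQ-≤ l 0≤e l≤e)

Disjoint : ∀ {n} → Cluster n → Cluster n → Set
Disjoint X Y = ∀ {x} → x ∈ₛ X → x ∈ₛ Y → ⊥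

Disjoint-sym : ∀ {n} {A B : Cluster n} → Disjoint A B → Disjoint B A
Disjoint-sym d x∈B x∈A = d x∈A x∈B

Disjoint-∪ˡ : ∀ {n} {X Y B : Cluster n} → Disjoint X B → Disjoint Y B → Disjoint (X ∪ Y) B
Disjoint-∪ˡ {X = X} {Y} dX dY x∈X∪Y x∈B =
  [ (λ x∈X → dX x∈X x∈B) , (λ x∈Y → dY x∈Y x∈B) ] (Subset.x∈p∪q⁻ X Y x∈X∪Y)

∣∪∣-disjoint : ∀ {n} (X Y : Cluster n) → Disjoint X Y → ∣ X ∪ Y ∣ ≡ ∣ X ∣ ℕ.+ ∣ Y ∣
∣∪∣-disjoint []          []          d = refl
∣∪∣-disjoint (true ∷ X)  (true ∷ Y)  d = ⊥-elim (d hereᵥ hereᵥ)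
∣∪∣-disjoint (true ∷ X)  (false ∷ Y) d = cong suc (∣∪∣-disjoint X Y (λ p q → d (thereᵥ p) (thereᵥ q)))
∣∪∣-disjoint (false ∷ X) (true ∷ Y)  d =
  trans (cong suc (∣∪∣-disjoint X Y (λ p q → d (thereᵥ p) (thereᵥ q)))) (sym (ℕ.+-suc ∣ X ∣ ∣ Y ∣))
∣∪∣-disjoint (false ∷ X) (false ∷ Y) d = ∣∪∣-disjoint X Y (λ p q → d (thereᵥ p) (thereᵥ q))

nonempty⇒∣∣>0 : ∀ {n} (X : Cluster n) → Nonempty X → 0 ℕ.< ∣ X ∣
nonempty⇒∣∣>0 X (x , x∈X) = ℕ.≤-<-trans ℕ.z≤n (Subset.x∈p⇒∣p-x∣<∣p∣ x∈X)

empty⇒∣∣≡0 : ∀ {n} (X : Cluster n) → ¬ Nonempty X → ∣ X ∣ ≡ 0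
empty⇒∣∣≡0 {n} X ¬ne = trans (cong ∣_∣ (Subset.Empty-unique ¬ne)) (Subset.∣⊥∣≡0 n)

∣∣≢0⇒nonempty : ∀ {n} (X : Cluster n) → ∣ X ∣ ≢ 0 → Nonempty X
∣∣≢0⇒nonempty X ∣X∣≢0 with Subset.nonempty? X
... | yes ne  = ne
... | no ¬ne = contradiction (empty⇒∣∣≡0 X ¬ne) ∣X∣≢0

lookup-∪ : ∀ {n} (X Y : Cluster n) x → lookup (X ∪ Y) x ≡ lookup X x ∨ lookup Y x
lookup-∪ X Y x = Vec.lookup-zipWith _∨_ x X Y

module _ {n} (G : WGraph n) where

  crossEdge : Cluster n → Cluster n → Fin n → Fin n → ℚ
  crossEdge X Y x y = if lookup X x ∧ lookup Y y then w G x y else 0ℚ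

  crossWeight≡∑∑ : ∀ X Y → crossWeight G X Y ≡ ∑[ x < n ] ∑[ y < n ] crossEdge X Y x y
  crossWeight≡∑∑ X Y = trans (sumQ-concatMap (λ x → map (crossEdge X Y x) (allFin n)) (allFin n))
    (trans (sumQ-allFin (λ x → sumQ (map (crossEdge X Y x) (allFin n))))
           (sum-cong-≗ (λ x → sumQ-allFin (crossEdge X Y x))))

  crossEdge-sym : ∀ X Y y x → crossEdge X Y x y ≡ crossEdge Y X y x
  crossEdge-sym X Y y x with lookup X x | lookup Y y
  ... | true  | true  = w-sym G x y
  ... | true  | false = refl
  ... | false | true  = refl
  ... | false | false = refl

  crossEdge-∪ˡ : ∀ {X Y} C → Disjoint X Y → ∀ x y →
                 crossEdge (X ∪ Y) C x y ≡ crossEdge X C x y + crossEdge Y C x y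
  crossEdge-∪ˡ {X} {Y} C d x y rewrite lookup-∪ X Y x
    with lookup X x in x∈X | lookup Y x in x∈Y | lookup C y
  ... | true  | true  | _     = ⊥-elim (d (Vec.lookup⇒[]= x X x∈X) (Vec.lookup⇒[]= x Y x∈Y))
  ... | true  | false | true  = sym (+-identityʳ _)
  ... | true  | false | false = refl
  ... | false | true  | true  = sym (+-identityˡ _)
  ... | false | true  | false = refl
  ... | false | false | _     = refl

  crossEdge-nonNeg : ∀ X Y x y → 0ℚ ≤ crossEdge X Y x y
  crossEdge-nonNeg X Y x y with lookup X x ∧ lookup Y y
  ... | true  = w-nonneg G x y
  ... | false = ≤-refl

  crossWeight-sym : ∀ X Y → crossWeight G X Y ≡ crossWeight G Y X
  crossWeight-sym X Y = begin
    crossWeight G X Y                        ≡⟨ crossWeight≡∑∑ X Y ⟩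
    ∑[ x < n ] ∑[ y < n ] crossEdge X Y x y  ≡⟨ ∑-comm (crossEdge X Y) ⟩
    ∑[ y < n ] ∑[ x < n ] crossEdge X Y x y  ≡⟨ sum-cong-≗ (λ y → sum-cong-≗ (crossEdge-sym X Y y)) ⟩
    ∑[ y < n ] ∑[ x < n ] crossEdge Y X y x  ≡⟨ crossWeight≡∑∑ Y X ⟨
    crossWeight G Y X                        ∎
    where open ≡-Reasoning

  crossWeight-∪ˡ : ∀ {X Y} C → Disjoint X Y →
                   crossWeight G (X ∪ Y) C ≡ crossWeight G X C + crossWeight G Y C
  crossWeight-∪ˡ {X} {Y} C d = begin
    crossWeight G (X ∪ Y) C
      ≡⟨ crossWeight≡∑∑ (X ∪ Y) C ⟩
    ∑[ x < n ] ∑[ y < n ] crossEdge (X ∪ Y) C x y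
      ≡⟨ sum-cong-≗ (λ x → sum-cong-≗ (crossEdge-∪ˡ C d x)) ⟩
    ∑[ x < n ] ∑[ y < n ] (crossEdge X C x y + crossEdge Y C x y)
      ≡⟨ sum-cong-≗ (λ x → ∑-distrib-+ (crossEdge X C x) (crossEdge Y C x)) ⟩
    ∑[ x < n ] (∑[ y < n ] crossEdge X C x y + ∑[ y < n ] crossEdge Y C x y)
      ≡⟨ ∑-distrib-+ (λ x → sum (crossEdge X C x)) (λ x → sum (crossEdge Y C x)) ⟩
    ∑[ x < n ] ∑[ y < n ] crossEdge X C x y + ∑[ x < n ] ∑[ y < n ] crossEdge Y C x y
      ≡⟨ cong₂ _+_ (crossWeight≡∑∑ X C) (crossWeight≡∑∑ Y C) ⟨
    crossWeight G X C + crossWeight G Y C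
      ∎
    where open ≡-Reasoning

  crossWeight-nonNeg : ∀ X Y → 0ℚ ≤ crossWeight G X Y
  crossWeight-nonNeg X Y = subst (0ℚ ≤_) (sym (crossWeight≡∑∑ X Y))
    (sum-nonNeg _ (λ x → sum-nonNeg (crossEdge X Y x) (crossEdge-nonNeg X Y x)))

  sim-sym : ∀ X Y → sim G X Y ≡ sim G Y X
  sim-sym X Y = cong₂ divQ (crossWeight-sym X Y) (cong toℚ (ℕ.*-comm (∣ X ∣) (∣ Y ∣)))

  sim-nonNeg : ∀ X Y → 0ℚ ≤ sim G X Y
  sim-nonNeg X Y = divQ-nonNeg (crossWeight-nonNeg X Y) (toℚ-nonNeg (∣ X ∣ ℕ.* ∣ Y ∣))

  -- Junk value: divQ p 0ℚ computes to 0ℚ.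
  sim-emptyʳ : ∀ A C → ∣ C ∣ ≡ 0 → sim G A C ≡ 0ℚ
  sim-emptyʳ A C ∣C∣≡0 =
    cong (λ k → divQ (crossWeight G A C) (toℚ k)) (trans (cong (∣ A ∣ ℕ.*_) ∣C∣≡0) (ℕ.*-zeroʳ ∣ A ∣))

  sim-pos⇒nonempty : ∀ X Y → 0ℚ < sim G X Y → Nonempty X × Nonempty Y
  sim-pos⇒nonempty X Y 0<sim =
    ∣∣≢0⇒nonempty X (λ ∣X∣≡0 → <⇒≢ 0<sim (sym (trans (sim-sym X Y) (sim-emptyʳ Y X ∣X∣≡0)))) ,
    ∣∣≢0⇒nonempty Y (λ ∣Y∣≡0 → <⇒≢ 0<sim (sym (sim-emptyʳ X Y ∣Y∣≡0)))

  sim-∪ˡ-split : ∀ {X Y} C → Disjoint X Y → sim G (X ∪ Y) C ≡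
    divQ (crossWeight G X C + crossWeight G Y C) (toℚ (∣ X ∣ ℕ.* ∣ C ∣) + toℚ (∣ Y ∣ ℕ.* ∣ C ∣))
  sim-∪ˡ-split {X} {Y} C d = cong₂ divQ (crossWeight-∪ˡ C d) (begin
    toℚ (∣ X ∪ Y ∣ ℕ.* ∣ C ∣)
      ≡⟨ cong (λ k → toℚ (k ℕ.* ∣ C ∣)) (∣∪∣-disjoint X Y d) ⟩
    toℚ ((∣ X ∣ ℕ.+ ∣ Y ∣) ℕ.* ∣ C ∣)
      ≡⟨ cong toℚ (ℕ.*-distribʳ-+ (∣ C ∣) (∣ X ∣) (∣ Y ∣)) ⟩
    toℚ (∣ X ∣ ℕ.* ∣ C ∣ ℕ.+ ∣ Y ∣ ℕ.* ∣ C ∣)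
      ≡⟨ toℚ-+ (∣ X ∣ ℕ.* ∣ C ∣) (∣ Y ∣ ℕ.* ∣ C ∣) ⟩
    toℚ (∣ X ∣ ℕ.* ∣ C ∣) + toℚ (∣ Y ∣ ℕ.* ∣ C ∣)
      ∎)
    where open ≡-Reasoning

  sim-∪ˡ : ∀ {X Y} C → Disjoint X Y → Nonempty X → Nonempty Y →
           sim G (X ∪ Y) C ≤ sim G X C ⊔ sim G Y C
  sim-∪ˡ {X} {Y} C d neX neY = by-cases (Subset.nonempty? C)
    where
    open ≤-Reasoning

    by-cases : Dec (Nonempty C) → sim G (X ∪ Y) C ≤ sim G X C ⊔ sim G Y C
    by-cases (no ¬neC) = begin
      sim G (X ∪ Y) C        ≡⟨ sim-emptyʳ (X ∪ Y) C (empty⇒∣∣≡0 C ¬neC) ⟩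
      0ℚ                     ≤⟨ sim-nonNeg X C ⟩
      sim G X C              ≤⟨ p≤p⊔q (sim G X C) (sim G Y C) ⟩
      sim G X C ⊔ sim G Y C  ∎
    by-cases (yes neC) = begin
      sim G (X ∪ Y) C
        ≡⟨ sim-∪ˡ-split C d ⟩
      divQ (crossWeight G X C + crossWeight G Y C) (toℚ (∣ X ∣ ℕ.* ∣ C ∣) + toℚ (∣ Y ∣ ℕ.* ∣ C ∣))
        ≤⟨ divQ-mediant (crossWeight G X C) (crossWeight G Y C) (weight-pos X neX) (weight-pos Y neY) ⟩
      sim G X C ⊔ sim G Y C
        ∎
      where
      weight-pos : ∀ A → Nonempty A → 0ℚ < toℚ (∣ A ∣ ℕ.* ∣ C ∣)
      weight-pos A neA = toℚ-*-pos (nonempty⇒∣∣>0 A neA) (nonempty⇒∣∣>0 C neC)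

_≟ᴹ_ : ∀ {n} (m m′ : Merge n) → Dec (m ≡ m′)
_≟ᴹ_ = Product.≡-dec _≟C_ _≟C_

Component : ∀ {n} → Cluster n → Merge n → Set
Component C (X , Y) = C ≡ X ⊎ C ≡ Y

component-∈ : ∀ {n} {P : Partition n} {X Y C} → X ∈ P → Y ∈ P → Component C (X , Y) → C ∈ P
component-∈ X∈P Y∈P (inj₁ refl) = X∈P
component-∈ X∈P Y∈P (inj₂ refl) = Y∈P

Merged : ∀ {n} → (Cluster n → Set) → Merge n → Cluster n → Set
Merged S m C = C ≡ result m ⊎ (S C × ¬ Component C m)

module _ {n} {C X Y : Cluster n} where

  kept⇒¬component : (not ⌊ C ≟C X ⌋ ∧ not ⌊ C ≟C Y ⌋) ≡ true → ¬ Component C (X , Y)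
  kept⇒¬component kept c with C ≟C X | C ≟C Y
  kept⇒¬component () c | yes _ | _
  kept⇒¬component () c | no _  | yes _
  ... | no C≢X | no C≢Y = [ C≢X , C≢Y ] c

  ¬component⇒kept : ¬ Component C (X , Y) → (not ⌊ C ≟C X ⌋ ∧ not ⌊ C ≟C Y ⌋) ≡ true
  ¬component⇒kept ¬c with C ≟C X | C ≟C Y
  ... | yes C≡X | _       = contradiction (inj₁ C≡X) ¬c
  ... | no _    | yes C≡Y = contradiction (inj₂ C≡Y) ¬c
  ... | no _    | no _    = refl

∈-applyMerge⁻ : ∀ {n} (P : Partition n) m {C} → C ∈ applyMerge P m → Merged (_∈ P) m C
∈-applyMerge⁻ P m (here C≡X∪Y) = inj₁ C≡X∪Y
∈-applyMerge⁻ P m (there C∈) =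
  let C∈P , kept = ∈-filter⁻ _ {xs = P} C∈ in inj₂ (C∈P , kept⇒¬component kept)

∈-applyMerge⁺ : ∀ {n} (P : Partition n) m {C} → Merged (_∈ P) m C → C ∈ applyMerge P m
∈-applyMerge⁺ P m (inj₁ C≡X∪Y)      = here C≡X∪Y
∈-applyMerge⁺ P m (inj₂ (C∈P , ¬c)) = there (∈-filter⁺ _ C∈P (¬component⇒kept ¬c))

module _ {n : ℕ} where

  PairwiseDisjoint : Partition n → Set
  PairwiseDisjoint P = ∀ {A B} → A ∈ P → B ∈ P → A ≢ B → Disjoint A B

  WellFormed : Partition n → Set
  WellFormed P = PairwiseDisjoint P × Unique P

  MergeableIn : Partition n → Merge n → Set
  MergeableIn P (X , Y) = X ∈ P × Y ∈ P × Nonempty X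

  ⁅⁆-injective : ∀ {a b : Fin n} → ⁅ a ⁆ ≡ ⁅ b ⁆ → a ≡ b
  ⁅⁆-injective {a} {b} e = Subset.x∈⁅y⁆⇒x≡y b (subst (a ∈ₛ_) e (Subset.x∈⁅x⁆ a))

  singletons-wellFormed : WellFormed (singletons n)
  singletons-wellFormed = disjoint , Unique.map⁺ ⁅⁆-injective (Unique.allFin⁺ n)
    where
    disjoint : PairwiseDisjoint (singletons n)
    disjoint A∈ B∈ A≢B x∈A x∈B with ∈-map⁻ ⁅_⁆ A∈ | ∈-map⁻ ⁅_⁆ B∈
    ... | a , _ , refl | b , _ , refl =
      A≢B (cong ⁅_⁆ (trans (sym (Subset.x∈⁅y⁆⇒x≡y a x∈A)) (Subset.x∈⁅y⁆⇒x≡y b x∈B)))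

  applyMerge-wellFormed : ∀ {P} m → WellFormed P → MergeableIn P m → WellFormed (applyMerge P m)
  applyMerge-wellFormed {P} (X , Y) (disjoint , unique) (X∈P , Y∈P , (x , x∈X)) =
    disjoint′ , (fresh ∷ Unique.filter⁺ _ unique)
    where
    merged-disjoint : ∀ {B} → B ∈ P → ¬ Component B (X , Y) → Disjoint (X ∪ Y) B
    merged-disjoint B∈P ¬c = Disjoint-∪ˡ (disjoint X∈P B∈P (λ X≡B → ¬c (inj₁ (sym X≡B))))
                                         (disjoint Y∈P B∈P (λ Y≡B → ¬c (inj₂ (sym Y≡B))))

    disjoint′ : PairwiseDisjoint (applyMerge P (X , Y))
    disjoint′ A∈ B∈ A≢B with ∈-applyMerge⁻ P (X , Y) A∈ | ∈-applyMerge⁻ P (X , Y) B∈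
    ... | inj₁ refl       | inj₁ refl       = contradiction refl A≢B
    ... | inj₁ refl       | inj₂ (B∈P , ¬c) = merged-disjoint B∈P ¬c
    ... | inj₂ (A∈P , ¬c) | inj₁ refl       = Disjoint-sym (merged-disjoint A∈P ¬c)
    ... | inj₂ (A∈P , _)  | inj₂ (B∈P , _)  = disjoint A∈P B∈P A≢B

    fresh : All (X ∪ Y ≢_) (List.filter _ P)
    fresh = All.tabulate λ C∈ X∪Y≡C →
      let C∈P , kept = ∈-filter⁻ _ {xs = P} C∈ in
      merged-disjoint C∈P (kept⇒¬component kept) (Subset.p⊆p∪q Y x∈X)
        (subst (x ∈ₛ_) X∪Y≡C (Subset.p⊆p∪q Y x∈X))

  applyMerges-take-wellFormed : ∀ {P} r → WellFormed P →
    (∀ (k : Fin (length r)) → MergeableIn (applyMerges P (take (toℕ k) r)) (List.lookup r k)) →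
    ∀ k → WellFormed (applyMerges P (take k r))
  applyMerges-take-wellFormed r       wf mergeable zero    = wf
  applyMerges-take-wellFormed []      wf mergeable (suc k) = wf
  applyMerges-take-wellFormed (m ∷ r) wf mergeable (suc k) =
    applyMerges-take-wellFormed r (applyMerge-wellFormed m wf (mergeable zero)) (mergeable ∘ suc) k

module _ {n : ℕ} where

  Created : Partition n → List (Merge n) → Cluster n → Set
  Created P r C = C ∈ P ⊎ ∃ λ m → m ∈ r × result m ≡ C

  Consumed : List (Merge n) → Cluster n → Set
  Consumed r C = ∃ λ m → m ∈ r × Component C m

  -- Describes the clusters of applyMerges P r without reference to the order of r.
  Alive : Partition n → List (Merge n) → Cluster n → Set
  Alive P r C = Created P r C × ¬ Consumed r C

  ChildrenFirst : List (Merge n) → Set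
  ChildrenFirst r = ∀ (i j : Fin (length r)) → IsChild (List.lookup r i) (List.lookup r j) → toℕ i ℕ.< toℕ j

  Alive-applyMerge⁺ : ∀ {P m r C} → Alive P (m ∷ r) C → Alive (applyMerge P m) r C
  Alive-applyMerge⁺ {P} {m} {r} {C} (created , unconsumed) = created′ created , unconsumed ∘ consumed-∷
    where
    consumed-∷ : Consumed r C → Consumed (m ∷ r) C
    consumed-∷ (m′ , m′∈r , c) = m′ , there m′∈r , c

    created′ : Created P (m ∷ r) C → Created (applyMerge P m) r C
    created′ (inj₁ C∈P) = inj₁ (∈-applyMerge⁺ P m (inj₂ (C∈P , λ c → unconsumed (m , here refl , c))))
    created′ (inj₂ (_ , here refl , e))   = inj₁ (∈-applyMerge⁺ P m (inj₁ (sym e)))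
    created′ (inj₂ (m′ , there m′∈r , e)) = inj₂ (m′ , m′∈r , e)

  Alive⇒∈-applyMerges : ∀ {P} r {C} → Alive P r C → C ∈ applyMerges P r
  Alive⇒∈-applyMerges []      (inj₁ C∈P , _)          = C∈P
  Alive⇒∈-applyMerges []      (inj₂ (_ , () , _) , _)
  Alive⇒∈-applyMerges (m ∷ r) alive                   = Alive⇒∈-applyMerges r (Alive-applyMerge⁺ alive)

  Created-applyMerge⁻ : ∀ P m {r C} → Created (applyMerge P m) r C → Created P (m ∷ r) C
  Created-applyMerge⁻ P m (inj₁ C∈P′) with ∈-applyMerge⁻ P m C∈P′
  ... | inj₁ C≡result  = inj₂ (m , here refl , sym C≡result)
  ... | inj₂ (C∈P , _) = inj₁ C∈P
  Created-applyMerge⁻ P m (inj₂ (m′ , m′∈r , e)) = inj₂ (m′ , there m′∈r , e)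

  Alive-applyMerge⁻ : ∀ {P m r C} → ¬ IsChild m m → (∀ {m′} → m′ ∈ r → ¬ IsChild m′ m) →
                      Alive (applyMerge P m) r C → Alive P (m ∷ r) C
  Alive-applyMerge⁻ {P} {m} {r} {C} ¬self ¬later (created , unconsumed) =
    Created-applyMerge⁻ P m created , unconsumed′
    where
    ¬component : Created (applyMerge P m) r C → ¬ Component C m
    ¬component (inj₂ (m′ , m′∈r , e)) c = ¬later m′∈r (subst (λ D → Component D m) (sym e) c)
    ¬component (inj₁ C∈P′)            c with ∈-applyMerge⁻ P m C∈P′
    ... | inj₁ C≡result = ¬self (subst (λ D → Component D m) C≡result c)
    ... | inj₂ (_ , ¬c) = ¬c c

    unconsumed′ : ¬ Consumed (m ∷ r) C
    unconsumed′ (_ , here refl , c)    = ¬component created c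
    unconsumed′ (m′ , there m′∈r , c) = unconsumed (m′ , m′∈r , c)

  ∈-applyMerges⇒Alive : ∀ {P} r → ChildrenFirst r → ∀ k {C} →
                        C ∈ applyMerges P (take k r) → Alive P (take k r) C
  ∈-applyMerges⇒Alive r       first zero    C∈P = inj₁ C∈P , λ ()
  ∈-applyMerges⇒Alive []      first (suc k) C∈P = inj₁ C∈P , λ ()
  ∈-applyMerges⇒Alive (m ∷ r) first (suc k) C∈  =
    Alive-applyMerge⁻ ¬self (λ m′∈ → ¬later (∈-take⁻ k r m′∈))
      (∈-applyMerges⇒Alive r (λ i j c → ℕ.s<s⁻¹ (first (suc i) (suc j) c)) k C∈)
    where
    ¬self : ¬ IsChild m m
    ¬self c = ℕ.<-irrefl refl (first zero zero c)

    ¬later : ∀ {m′} → m′ ∈ r → ¬ IsChild m′ m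
    ¬later m′∈r c
      with first (suc (Any.index m′∈r)) zero (subst (λ m″ → IsChild m″ m) (Any.lookup-index m′∈r) c)
    ... | ()

  Alive-resp-⊆-⊇ : ∀ {P r r′ C} → (∀ {m} → m ∈ r → m ∈ r′) → (∀ {m} → m ∈ r′ → m ∈ r) →
                   Alive P r C → Alive P r′ C
  Alive-resp-⊆-⊇ r⊆r′ r′⊆r (created , unconsumed) =
    [ inj₁ , (λ (m , m∈r , e) → inj₂ (m , r⊆r′ m∈r , e)) ] created ,
    λ (m , m∈r′ , c) → unconsumed (m , r′⊆r m∈r′ , c)

  Consumed-++⁺ˡ : ∀ {M r C} → Consumed M C → Consumed (M ++ r) C
  Consumed-++⁺ˡ (m , m∈M , c) = m , ∈-++⁺ˡ m∈M , c

  Created-∷ʳ⁻ : ∀ {P M m C} → Created P (M ∷ʳ m) C → Created P M C ⊎ result m ≡ C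
  Created-∷ʳ⁻ (inj₁ C∈P) = inj₁ (inj₁ C∈P)
  Created-∷ʳ⁻ {M = M} (inj₂ (m′ , m′∈ , e)) =
    [ (λ m′∈M → inj₁ (inj₂ (m′ , m′∈M , e))) ,
      (λ m′≡m → inj₂ (trans (cong result (sym m′≡m)) e)) ] (∈-∷ʳ⁻ M m′∈)

  Alive-∷ʳ-∈ : ∀ {P M m C} → m ∈ M → Alive P (M ∷ʳ m) C → Alive P M C
  Alive-∷ʳ-∈ {m = m} m∈M (created , unconsumed) =
    [ (λ c → c) , (λ e → inj₂ (m , m∈M , e)) ] (Created-∷ʳ⁻ created) , unconsumed ∘ Consumed-++⁺ˡ

  Alive-∷ʳ : ∀ {P M m C} → Alive P (M ∷ʳ m) C → Merged (Alive P M) m C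
  Alive-∷ʳ {M = M} {m} {C} (created , unconsumed) = by-cases (C ≟C result m)
    where
    by-cases : Dec (C ≡ result m) → Merged (Alive _ M) m C
    by-cases (yes C≡result) = inj₁ C≡result
    by-cases (no C≢result)  =
      inj₂ (([ (λ c → c) , (λ e → contradiction (sym e) C≢result) ] (Created-∷ʳ⁻ created) ,
             unconsumed ∘ Consumed-++⁺ˡ) ,
            λ c → unconsumed (m , ∈-++⁺ʳ M (here refl) , c))

module _ {n} (G : WGraph n) where

  ∈-pairSims⁺ : ∀ {P A B} → A ∈ P → B ∈ P → A ≢ B → sim G A B ∈ pairSims G P
  ∈-pairSims⁺ {Z ∷ P} (here refl) (here refl) A≢B = contradiction refl A≢B
  ∈-pairSims⁺ {Z ∷ P} (here refl) (there B∈P) _   = ∈-++⁺ˡ (∈-map⁺ (sim G Z) B∈P)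
  ∈-pairSims⁺ {Z ∷ P} {A} (there A∈P) (here refl) _ =
    subst (_∈ pairSims G (Z ∷ P)) (sim-sym G Z A) (∈-++⁺ˡ (∈-map⁺ (sim G Z) A∈P))
  ∈-pairSims⁺ {Z ∷ P} (there A∈P) (there B∈P) A≢B =
    ∈-++⁺ʳ (map (sim G Z) P) (∈-pairSims⁺ A∈P B∈P A≢B)

  IsPairSim : Partition n → ℚ → Set
  IsPairSim P x = ∃₂ λ A B → A ∈ P × B ∈ P × A ≢ B × x ≡ sim G A B

  ∈-pairSims⁻ : ∀ {P x} → Unique P → x ∈ pairSims G P → IsPairSim P x
  ∈-pairSims⁻ {A ∷ P} (A∉P ∷ unique) x∈ = [ in-row , in-rest ] (∈-++⁻ (map (sim G A) P) x∈)
    where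
    in-row : ∀ {x} → x ∈ map (sim G A) P → IsPairSim (A ∷ P) x
    in-row x∈row = let B , B∈P , x≡ = ∈-map⁻ (sim G A) x∈row in
      A , B , here refl , there B∈P , All.lookup A∉P B∈P , x≡

    in-rest : ∀ {x} → x ∈ pairSims G P → IsPairSim (A ∷ P) x
    in-rest x∈rest = let A′ , B′ , A′∈P , B′∈P , A′≢B′ , x≡ = ∈-pairSims⁻ unique x∈rest in
      A′ , B′ , there A′∈P , there B′∈P , A′≢B′ , x≡

  maxEdge-nonNeg : ∀ P → 0ℚ ≤ maxEdge G P
  maxEdge-nonNeg P = maxQ-nonNeg (pairSims G P)

  SimBound : (Cluster n → Set) → ℚ → Set
  SimBound S e = ∀ {A B} → S A → S B → A ≢ B → sim G A B ≤ e

  SimBound-restrict : ∀ {S S′ e} → (∀ {C} → S′ C → S C) → SimBound S e → SimBound S′ e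
  SimBound-restrict S′⊆S bound A∈ B∈ = bound (S′⊆S A∈) (S′⊆S B∈)

  maxEdge-SimBound : ∀ P → SimBound (_∈ P) (maxEdge G P)
  maxEdge-SimBound P A∈P B∈P A≢B = maxQ-≥ (pairSims G P) (∈-pairSims⁺ A∈P B∈P A≢B)

  SimBound⇒maxEdge-≤ : ∀ {P e} → Unique P → 0ℚ ≤ e → SimBound (_∈ P) e → maxEdge G P ≤ e
  SimBound⇒maxEdge-≤ {P} {e} unique 0≤e bound = maxQ-≤ (pairSims G P) 0≤e (All.tabulate λ x∈ →
    let _ , _ , A∈P , B∈P , A≢B , x≡ = ∈-pairSims⁻ unique x∈ in
    subst (_≤ e) (sym x≡) (bound A∈P B∈P A≢B))

  Terminal⇒SimBound : ∀ {P} → Terminal G P → SimBound (_∈ P) 0ℚ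
  Terminal⇒SimBound terminal A∈P B∈P A≢B = ≤-reflexive (All.lookup terminal (∈-pairSims⁺ A∈P B∈P A≢B))

  SimBound⇒Terminal : ∀ {P} → Unique P → SimBound (_∈ P) 0ℚ → Terminal G P
  SimBound⇒Terminal unique bound = All.tabulate λ x∈ →
    let A , B , A∈P , B∈P , A≢B , x≡ = ∈-pairSims⁻ unique x∈ in
    trans x≡ (≤-antisym (bound A∈P B∈P A≢B) (sim-nonNeg G A B))

  SimBound-merge : ∀ {S e X Y} → SimBound S e → S X → S Y → Disjoint X Y → Nonempty X → Nonempty Y →
                   SimBound (Merged S (X , Y)) e
  SimBound-merge {S} {e} {X} {Y} bound X∈S Y∈S d neX neY = bound′
    where
    merged-bound : ∀ {B} → S B → ¬ Component B (X , Y) → sim G (X ∪ Y) B ≤ e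
    merged-bound {B} B∈S ¬c = ≤-trans (sim-∪ˡ G B d neX neY)
      (⊔-lub (bound X∈S B∈S (λ X≡B → ¬c (inj₁ (sym X≡B))))
             (bound Y∈S B∈S (λ Y≡B → ¬c (inj₂ (sym Y≡B)))))

    bound′ : SimBound (Merged S (X , Y)) e
    bound′ (inj₁ refl)           (inj₁ refl)       A≢B = contradiction refl A≢B
    bound′ (inj₁ refl)           (inj₂ (B∈S , ¬c)) _   = merged-bound B∈S ¬c
    bound′ {A} (inj₂ (A∈S , ¬c)) (inj₁ refl)       _   =
      subst (_≤ e) (sim-sym G (X ∪ Y) A) (merged-bound A∈S ¬c)
    bound′ (inj₂ (A∈S , _))      (inj₂ (B∈S , _))  A≢B = bound A∈S B∈S A≢B

module Run {n} (G : WGraph n) where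

  run-sim-pos : ∀ {P ms m} → RunFrom G P ms → m ∈ ms → 0ℚ < simM G m
  run-sim-pos (_ , _ , _ , pos , _) (here refl) = pos
  run-sim-pos (_ , _ , _ , _ , run) (there m∈)  = run-sim-pos run m∈

  run-step-wellFormed : ∀ {P X Y ms} → RunFrom G P ((X , Y) ∷ ms) → WellFormed P →
                        WellFormed (applyMerge P (X , Y))
  run-step-wellFormed {X = X} {Y} (X∈P , Y∈P , _ , pos , _) wf =
    applyMerge-wellFormed (X , Y) wf (X∈P , Y∈P , proj₁ (sim-pos⇒nonempty G X Y pos))

  run-disjoint : ∀ {P ms m} → RunFrom G P ms → WellFormed P → m ∈ ms → Disjoint (proj₁ m) (proj₂ m)
  run-disjoint {ms = _ ∷ _} (X∈P , Y∈P , X≢Y , _) (disjoint , _) (here refl) = disjoint X∈P Y∈P X≢Y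
  run-disjoint {ms = _ ∷ _} run@(_ , _ , _ , _ , run′) wf (there m∈) =
    run-disjoint run′ (run-step-wellFormed run wf) m∈

  run-terminal : ∀ {P} ms → RunFrom G P ms → Terminal G (applyMerges P ms)
  run-terminal []       terminal              = terminal
  run-terminal (_ ∷ ms) (_ , _ , _ , _ , run) = run-terminal ms run

  run-component-created : ∀ {P ms m C} → RunFrom G P ms → m ∈ ms → Component C m → Created P ms C
  run-component-created (X∈P , Y∈P , _) (here refl) c = inj₁ (component-∈ X∈P Y∈P c)
  run-component-created {P} {m′ ∷ _} (_ , _ , _ , _ , run) (there m∈) c =
    Created-applyMerge⁻ P m′ (run-component-created run m∈ c)

  run-grows : ∀ {P ms A m C} → RunFrom G P ms → WellFormed P → A ∈ P → m ∈ ms → Component C m →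
              ¬ Disjoint A C → A ⊆ₛ C
  run-grows {A = A} {C = C} (X∈P , Y∈P , _) (disjoint , _) A∈P (here refl) c meets = by-cases (A ≟C C)
    where
    by-cases : Dec (A ≡ C) → A ⊆ₛ C
    by-cases (yes A≡C) = subst (A ⊆ₛ_) A≡C (λ x∈A → x∈A)
    by-cases (no A≢C)  = ⊥-elim (meets (disjoint A∈P (component-∈ X∈P Y∈P c) A≢C))
  run-grows {P} {(X , Y) ∷ _} {A} {C = C} run@(_ , _ , _ , _ , run′) wf A∈P (there m∈) c meets =
    by-cases (A ≟C X) (A ≟C Y)
    where
    wf′ = run-step-wellFormed run wf

    grown-by : A ⊆ₛ X ∪ Y → A ⊆ₛ C
    grown-by A⊆X∪Y x∈A = X∪Y⊆C (A⊆X∪Y x∈A)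
      where
      X∪Y⊆C : X ∪ Y ⊆ₛ C
      X∪Y⊆C = run-grows run′ wf′ (∈-applyMerge⁺ P (X , Y) (inj₁ refl)) m∈ c
                (λ d → meets (λ x∈A x∈C → d (A⊆X∪Y x∈A) x∈C))

    by-cases : Dec (A ≡ X) → Dec (A ≡ Y) → A ⊆ₛ C
    by-cases (yes A≡X) _         = grown-by (λ x∈A → Subset.p⊆p∪q Y (subst (_ ∈ₛ_) A≡X x∈A))
    by-cases (no _)    (yes A≡Y) = grown-by (λ x∈A → Subset.q⊆p∪q X Y (subst (_ ∈ₛ_) A≡Y x∈A))
    by-cases (no A≢X)  (no A≢Y)  =
      run-grows run′ wf′ (∈-applyMerge⁺ P (X , Y) (inj₂ (A∈P , [ A≢X , A≢Y ]))) m∈ c meets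

  run-consumed-once : ∀ {P X Y ms m′ C} → RunFrom G P ((X , Y) ∷ ms) → WellFormed P →
             Component C (X , Y) → m′ ∈ ms → ¬ Component C m′
  run-consumed-once {P} {X} {Y} run@(X∈P , Y∈P , X≢Y , pos , run′) wf c m′∈ c′ =
    collapse c (run-grows run′ (run-step-wellFormed run wf) (∈-applyMerge⁺ P (X , Y) (inj₁ refl))
                          m′∈ c′ (meets c))
    where
    x∈X = proj₂ (proj₁ (sim-pos⇒nonempty G X Y pos))
    y∈Y = proj₂ (proj₂ (sim-pos⇒nonempty G X Y pos))

    X∩Y=∅ : Disjoint X Y
    X∩Y=∅ = proj₁ wf X∈P Y∈P X≢Y

    meets : ∀ {C} → Component C (X , Y) → ¬ Disjoint (X ∪ Y) C
    meets (inj₁ refl) d = d (Subset.p⊆p∪q Y x∈X) x∈X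
    meets (inj₂ refl) d = d (Subset.q⊆p∪q X Y y∈Y) y∈Y

    collapse : ∀ {C} → Component C (X , Y) → ¬ (X ∪ Y ⊆ₛ C)
    collapse (inj₁ refl) X∪Y⊆X = X∩Y=∅ (X∪Y⊆X (Subset.q⊆p∪q X Y y∈Y)) y∈Y
    collapse (inj₂ refl) X∪Y⊆Y = X∩Y=∅ x∈X (X∪Y⊆Y (Subset.p⊆p∪q Y x∈X))

  run-component-unique : ∀ {P ms m m′ C} → RunFrom G P ms → WellFormed P → m ∈ ms → m′ ∈ ms →
                         Component C m → Component C m′ → m ≡ m′
  run-component-unique run wf (here refl) (here refl) c c′ = refl
  run-component-unique run wf (here refl) (there m′∈) c c′ = ⊥-elim (run-consumed-once run wf c m′∈ c′)
  run-component-unique run wf (there m∈)  (here refl) c c′ = ⊥-elim (run-consumed-once run wf c′ m∈ c)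
  run-component-unique {ms = _ ∷ _} run@(_ , _ , _ , _ , run′) wf (there m∈) (there m′∈) c c′ =
    run-component-unique run′ (run-step-wellFormed run wf) m∈ m′∈ c c′

module Dendrogram {n} {G : WGraph n} {D : List (Merge n)} (isD : IsDendrogram G D) where
  open Run G

  merge-sim-pos : ∀ {m} → m ∈ D → 0ℚ < simM G m
  merge-sim-pos = run-sim-pos isD

  merge-disjoint : ∀ {m} → m ∈ D → Disjoint (proj₁ m) (proj₂ m)
  merge-disjoint = run-disjoint isD singletons-wellFormed

  merge-nonempty : ∀ {m} → m ∈ D → Nonempty (proj₁ m) × Nonempty (proj₂ m)
  merge-nonempty {X , Y} m∈D = sim-pos⇒nonempty G X Y (merge-sim-pos m∈D)

  AliveAfter : List (Merge n) → Cluster n → Set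
  AliveAfter = Alive (singletons n)

  components-alive : ∀ {M m C} → (∀ {m′} → m′ ∈ M → m′ ∈ D) → m ∈ D → m ∉ M → Available D M m →
                     Component C m → AliveAfter M C
  components-alive {M} {m} {C} M⊆D m∈D m∉M available c = created , unconsumed
    where
    created : Created (singletons n) M C
    created with run-component-created isD m∈D c
    ... | inj₁ C∈singletons    = inj₁ C∈singletons
    ... | inj₂ (m″ , m″∈D , e) =
      inj₂ (m″ , available m″ m″∈D (subst (λ C′ → Component C′ m) (sym e) c) , e)

    unconsumed : ¬ Consumed M C
    unconsumed (m′ , m′∈M , c′) =
      m∉M (subst (_∈ M) (sym (run-component-unique isD singletons-wellFormed m∈D (M⊆D m′∈M) c c′)) m′∈M)

  SimBound-∷ʳ : ∀ {M m e} → (∀ {m′} → m′ ∈ M → m′ ∈ D) → m ∈ D → Available D M m →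
                SimBound G (AliveAfter M) e → SimBound G (AliveAfter (M ∷ʳ m)) e
  SimBound-∷ʳ {M} {m} {e} M⊆D m∈D available bound = by-cases (Any.any? (m ≟ᴹ_) M)
    where
    by-cases : Dec (m ∈ M) → SimBound G (AliveAfter (M ∷ʳ m)) e
    by-cases (yes m∈M) = SimBound-restrict G (Alive-∷ʳ-∈ m∈M) bound
    by-cases (no m∉M)  = SimBound-restrict G Alive-∷ʳ
      (SimBound-merge G bound (components-alive M⊆D m∈D m∉M available (inj₁ refl))
                              (components-alive M⊆D m∈D m∉M available (inj₂ refl))
                              (merge-disjoint m∈D) (proj₁ (merge-nonempty m∈D)) (proj₂ (merge-nonempty m∈D)))

  SimBound-prefixes : ∀ {e} M r → (∀ {m} → m ∈ M → m ∈ D) → (∀ {m} → m ∈ r → m ∈ D) →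
    (∀ (k : Fin (length r)) → Available D (M ++ take (toℕ k) r) (List.lookup r k)) →
    SimBound G (AliveAfter M) e → ∀ k → SimBound G (AliveAfter (M ++ take k r)) e
  SimBound-prefixes {e} M r M⊆D r⊆D available bound zero =
    subst (λ M′ → SimBound G (AliveAfter M′) e) (sym (List.++-identityʳ M)) bound
  SimBound-prefixes {e} M [] M⊆D r⊆D available bound (suc k) =
    subst (λ M′ → SimBound G (AliveAfter M′) e) (sym (List.++-identityʳ M)) bound
  SimBound-prefixes {e} M (m ∷ r) M⊆D r⊆D available bound (suc k) =
    subst (λ M′ → SimBound G (AliveAfter M′) e) (List.++-assoc M List.[ m ] (take k r))
      (SimBound-prefixes (M ∷ʳ m) r M∷ʳm⊆D (r⊆D ∘ there) available′ bound′ k)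
    where
    M∷ʳm⊆D : ∀ {m′} → m′ ∈ M ∷ʳ m → m′ ∈ D
    M∷ʳm⊆D m′∈ = [ M⊆D , (λ m′≡m → subst (_∈ D) (sym m′≡m) (r⊆D (here refl))) ] (∈-∷ʳ⁻ M m′∈)

    bound′ : SimBound G (AliveAfter (M ∷ʳ m)) e
    bound′ = SimBound-∷ʳ M⊆D (r⊆D (here refl))
      (subst (λ p → Available D p m) (List.++-identityʳ M) (available zero)) bound

    available′ : ∀ (k : Fin (length r)) → Available D ((M ∷ʳ m) ++ take (toℕ k) r) (List.lookup r k)
    available′ k = subst (λ p → Available D p (List.lookup r k))
      (sym (List.++-assoc M List.[ m ] (take (toℕ k) r))) (available (suc k))

module Greedy {n} {G : WGraph n} {D : List (Merge n)} (isD : IsDendrogram G D)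
              {s : List (Merge n)} (greedy : IsGreedy G D s) where
  open Dendrogram isD

  s↭D : s ↭ D
  s↭D = proj₁ greedy

  fresh : ∀ k → List.lookup s k ∉ take (toℕ k) s
  fresh k = proj₁ (proj₂ greedy k)

  available : ∀ k → Available D (take (toℕ k) s) (List.lookup s k)
  available k = proj₁ (proj₂ (proj₂ greedy k))

  maximal : ∀ k m → m ∈ D → m ∉ take (toℕ k) s → Available D (take (toℕ k) s) m →
            simM G m ≤ simM G (List.lookup s k)
  maximal k = proj₂ (proj₂ (proj₂ greedy k))

  s⊆D : ∀ {m} → m ∈ s → m ∈ D
  s⊆D = ∈-resp-↭ s↭D

  lookup∈D : ∀ k → List.lookup s k ∈ D
  lookup∈D k = s⊆D (∈-lookup k)

  childrenFirst : ChildrenFirst s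
  childrenFirst i j child = ℕ.≰⇒> λ j≤i →
    fresh i (sublist-lookup (take⁺ j≤i) (available j (List.lookup s i) (lookup∈D i) child))

  before-wellFormed : ∀ k → WellFormed (before s k)
  before-wellFormed = applyMerges-take-wellFormed s singletons-wellFormed mergeable
    where
    mergeable : ∀ k → MergeableIn (before s (toℕ k)) (List.lookup s k)
    mergeable k = ∈before (inj₁ refl) , ∈before (inj₂ refl) , proj₁ (merge-nonempty (lookup∈D k))
      where
      ∈before : ∀ {C} → Component C (List.lookup s k) → C ∈ before s (toℕ k)
      ∈before c = Alive⇒∈-applyMerges (take (toℕ k) s)
        (components-alive (s⊆D ∘ ∈-take⁻ (toℕ k) s) (lookup∈D k) (fresh k) (available k) c)

  take-length : take (length s) s ≡ s
  take-length = List.take-all (length s) s ℕ.≤-refl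

  terminal : Terminal G (applyMerges (singletons n) s)
  terminal = SimBound⇒Terminal G unique
    (SimBound-restrict G ∈final-D (Terminal⇒SimBound G (Run.run-terminal G D isD)))
    where
    unique : Unique (applyMerges (singletons n) s)
    unique = subst (Unique ∘ applyMerges (singletons n)) take-length (proj₂ (before-wellFormed (length s)))

    ∈final-D : ∀ {C} → C ∈ applyMerges (singletons n) s → C ∈ applyMerges (singletons n) D
    ∈final-D {C} C∈ = Alive⇒∈-applyMerges D (Alive-resp-⊆-⊇ s⊆D (∈-resp-↭ (↭-sym s↭D))
      (subst (λ r → AliveAfter r C) take-length
        (∈-applyMerges⇒Alive s childrenFirst (length s)
          (subst (λ r → C ∈ applyMerges (singletons n) r) (sym take-length) C∈))))

  approximate : ∀ α → (∀ j → errorAt G s j ≤ α) → Approximate G D α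
  approximate α error≤α =
    s , (s↭D , childrenFirst) , (λ j → divQ-≤⇒≤-* (merge-sim-pos (lookup∈D j)) (error≤α j)) , terminal

  maxEdge-before-≤ : ∀ j {pt} → All (_∈ take j s) pt →
                     maxEdge G (before s j) ≤ maxEdge G (applyMerges (singletons n) pt)
  maxEdge-before-≤ j {pt} pt⊆pj = SimBound⇒maxEdge-≤ G (proj₂ (before-wellFormed j))
    (maxEdge-nonNeg G (applyMerges (singletons n) pt)) (SimBound-restrict G alive bound)
    where
    pt⊆D : ∀ {m} → m ∈ pt → m ∈ D
    pt⊆D m∈pt = s⊆D (∈-take⁻ j s (All.lookup pt⊆pj m∈pt))

    bound : SimBound G (AliveAfter (pt ++ take j s)) (maxEdge G (applyMerges (singletons n) pt))
    bound = SimBound-prefixes pt s pt⊆D s⊆D (λ k c c∈D child → ∈-++⁺ʳ pt (available k c c∈D child))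
      (SimBound-restrict G (Alive⇒∈-applyMerges pt) (maxEdge-SimBound G (applyMerges (singletons n) pt))) j

    alive : ∀ {C} → C ∈ before s j → AliveAfter (pt ++ take j s) C
    alive C∈ = Alive-resp-⊆-⊇ (∈-++⁺ʳ pt)
      (λ m∈ → [ All.lookup pt⊆pj , (λ m∈pj → m∈pj) ] (∈-++⁻ pt m∈))
      (∈-applyMerges⇒Alive s childrenFirst j C∈)

  first-unperformed : ∀ (j : Fin (length s)) {s′} → s′ ↭ D → ChildrenFirst s′ → ∃ λ t →
    List.lookup s′ t ∉ take (toℕ j) s × All (_∈ take (toℕ j) s) (take (toℕ t) s′) ×
    Available D (take (toℕ j) s) (List.lookup s′ t)
  first-unperformed j {s′} s′↭D s′-first = t , First.index-satisfied first , prefix⊆pj , available′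
    where
    pj = take (toℕ j) s

    first : First (_∈ pj) (_∉ pj) s′
    first = First.¬All⇒First (λ m → Any.any? (m ≟ᴹ_) pj) (λ m∉ → m∉)
      (λ all → fresh j (All.lookup all (∈-resp-↭ (↭-sym s′↭D) (lookup∈D j))))

    t = First.index first
    prefix⊆pj = First-prefix first

    available′ : Available D pj (List.lookup s′ t)
    available′ c c∈D child = All.lookup prefix⊆pj (subst (_∈ take (toℕ t) s′) (sym c≡)
      (lookup∈take s′ i (s′-first i t (subst (λ c′ → IsChild c′ _) c≡ child))))
      where
      c∈s′ = ∈-resp-↭ (↭-sym s′↭D) c∈D
      i = Any.index c∈s′
      c≡ = Any.lookup-index c∈s′

  error-≤ : ∀ {β} j → Approximate G D β → errorAt G s j ≤ β
  error-≤ {β} j (s′ , (s′↭D , s′-first) , s′-approximate , _) =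
    let t , m∉pj , pt⊆pj , m-available = first-unperformed j s′↭D s′-first
        m = List.lookup s′ t
        m∈D = ∈-resp-↭ s′↭D (∈-lookup t)
    in *-cancel-≤-smaller (merge-sim-pos m∈D) (maximal j m m∈D m∉pj m-available)
         (≤-trans (maxEdge-nonNeg G (before s′ (toℕ t))) (s′-approximate t)) (begin
           errorAt G s j * simM G (List.lookup s j)  ≡⟨ divQ-*-cancel _ (merge-sim-pos (lookup∈D j)) ⟩
           maxEdge G (before s (toℕ j))             ≤⟨ maxEdge-before-≤ (toℕ j) pt⊆pj ⟩
           maxEdge G (before s′ (toℕ t))            ≤⟨ s′-approximate t ⟩
           β * simM G m                             ∎)
    where open ≤-Reasoning

lemma3p6 : (n : ℕ) (G : WGraph n) (D : List (Merge n)) → IsDendrogram G D →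
    (s : List (Merge n)) → IsGreedy G D s →
    (ε : ℚ) → IsMaxError G s (1ℚ + ε) →
    Approximate G D (1ℚ + ε) × (∀ (ε′ : ℚ) → ε′ < ε → ¬ Approximate G D (1ℚ + ε′))
lemma3p6 n G D isD s greedy ε ((j , error≡1+ε) , error≤1+ε) =
  approximate (1ℚ + ε) error≤1+ε ,
  λ ε′ ε′<ε approx →
    <-irrefl refl (<-≤-trans (+-monoʳ-< 1ℚ ε′<ε) (subst (_≤ 1ℚ + ε′) error≡1+ε (error-≤ j approx)))
  where open Greedy isD greedy
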